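{- Let $G$ be a finite group, $\Gamma_G$ its power graph and $M_G$ the set of maximal involutions of $G$. If $|M_G|\ge 3$, then $\mathrm{rc}(\Gamma_G)=|M_G|$.
   Context: For a finite group $G$ with identity $e$, the power graph $\Gamma_G$ is the undirected graph with vertex set $G$ in which two distinct elements are adjacent if one is a power of the other. An involution is an element of order $2$. An involution $x$ is maximal if the only cyclic subgroup of $G$ containing $x$ is $\langle x\rangle$; $M_G$ denotes the set of maximal involutions of $G$. For a connected graph $\Gamma$, an edge coloring $\zeta:E(\Gamma)\to\{1,\dots,k\}$ (adjacent edges may receive the same color) is a rainbow $k$-coloring if every pair of vertices is joined by a path whose edges have pairwise distinct colors; the rainbow connection number $\mathrm{rc}(\Gamma)$ is the minimum $k$ for which a rainbow $k$-coloring exists. -}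

module Defs where

open import Level using (0ℓ)
open import Data.Nat using (ℕ; zero; suc; _≤_)
open import Data.Fin using (Fin)
open import Data.List using (List; []; _∷_; [_]; length)
open import Data.List.Membership.Propositional using (_∈_)
open import Data.List.Relation.Unary.Unique.Propositional using (Unique)
open import Data.Product using (Σ; ∃; _×_; _,_)
open import Data.Sum using (_⊎_)
open import Relation.Nullary using (¬_)
open import Relation.Binary.PropositionalEquality using (_≡_)
open import Function.Bundles using (_⇔_)
open import Algebra.Structures using (IsGroup)

-- Finite groups: a group structure on Fin n (every finite group is
-- isomorphic to one of these), with propositional equality.

record FiniteGroup : Set₁ where
  field
    n       : ℕ
    _∙_     : Fin n → Fin n → Fin n
    ε       : Fin n
    _⁻¹     : Fin n → Fin n
    isGroup : IsGroup _≡_ _∙_ ε _⁻¹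

module _ (G : FiniteGroup) where
  open FiniteGroup G

  pow : Fin n → ℕ → Fin n
  pow x zero    = ε
  pow x (suc k) = x ∙ pow x k

  -- z ∈ ⟨y⟩  (in a finite group ⟨y⟩ = {y^k | k ∈ ℕ})
  InCyclic : Fin n → Fin n → Set
  InCyclic y z = ∃ λ k → pow y k ≡ z

  PowerAdj : Fin n → Fin n → Set
  PowerAdj x y = ¬ (x ≡ y) × (InCyclic x y ⊎ InCyclic y x)

  IsInvolution : Fin n → Set
  IsInvolution x = ¬ (x ≡ ε) × (x ∙ x ≡ ε)

  -- x is a maximal involution: the only cyclic subgroup containing x is ⟨x⟩
  IsMaximalInvolution : Fin n → Set
  IsMaximalInvolution x =
    IsInvolution x ×
    (∀ y → InCyclic y x → ∀ z → InCyclic y z ⇔ InCyclic x z)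

  -- |M_G| = m : there is a duplicate-free list enumerating exactly M_G,
  -- of length m
  NumMaxInvolutions : ℕ → Set
  NumMaxInvolutions m =
    Σ (List (Fin n)) λ xs →
      Unique xs × (∀ x → (x ∈ xs) ⇔ IsMaximalInvolution x) × length xs ≡ m

-- Rainbow connection for a graph on vertex set Fin N with adjacency E
-- (E assumed symmetric and irreflexive).

module _ {N : ℕ} (E : Fin N → Fin N → Set) where

  -- an edge coloring with colors {1..k} (represented by Fin k): a
  -- colour for each edge, independent of orientation / proof of adjacency
  record EdgeColoring (k : ℕ) : Set where
    field
      col  : ∀ x y → E x y → Fin k
      symm : ∀ x y (p : E x y) (q : E y x) → col x y p ≡ col y x q

  data ColWalk {k : ℕ} (c : ∀ x y → E x y → Fin k)
       : Fin N → Fin N → List (Fin N) → List (Fin k) → Set where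
    here : ∀ x → ColWalk c x x [ x ] []
    step : ∀ {x y z vs cs} (e : E x y) → ColWalk c y z vs cs →
           ColWalk c x z (x ∷ vs) (c x y e ∷ cs)

  RainbowPath : ∀ {k} → EdgeColoring k → Fin N → Fin N → Set
  RainbowPath ζ u v = Σ (List (Fin N)) λ vs → Σ (List (Fin _)) λ cs →
    ColWalk (EdgeColoring.col ζ) u v vs cs × Unique vs × Unique cs

  IsRainbowColoring : ∀ {k} → EdgeColoring k → Set
  IsRainbowColoring ζ = ∀ u v → RainbowPath ζ u v

  HasRainbowColoring : ℕ → Set
  HasRainbowColoring k = Σ (EdgeColoring k) IsRainbowColoring

  RainbowConnectionNumber : ℕ → Set
  RainbowConnectionNumber r =
    HasRainbowColoring r × (∀ k → HasRainbowColoring k → r ≤ k)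

-- The identity ε is adjacent to every other vertex of Γ_G (a "hub"), and the
-- maximal involutions are exactly the pendant vertices hanging off ε.
--
-- Lower bound (module PendantBound): in any graph, m distinct pendant vertices
-- attached to a common hub force m colours, since a rainbow path between two of
-- them consists of their two hub edges followed/preceded by nothing else.
--
-- Upper bound (module HubColouring): colour each vertex v by κ v and the hub edge
-- {h, v} by κ v.  Vertices of different κ-colour are joined through the hub.  If
-- every vertex that is not a "leaf" (leaves having pairwise distinct κ) owns a
-- partner edge {d v, v} whose colour δ v and endpoint colour κ (d v) are new, then
-- two vertices of equal κ-colour are joined by  u – h – d v – v  or  u – d u – h – v.
--
-- For the power graph with M ≥ 3 colours: maximal involutions get their index in
-- the enumeration of M_G; a non-maximal involution t gets colour 2 and partners
-- with a proper root w of t; a non-involution x gets colour 0 or 1 (opposite to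
-- x⁻¹) and partners with x⁻¹ via an edge of colour 2.
module Submission where

open import Level using (0ℓ)
open import Defs
open import Data.Nat using (ℕ; zero; suc; _+_; _≤_; _<_; z≤n; s≤s; _<?_)
open import Data.Nat.Properties
  using (+-comm; ≤-refl; m≤n⇒∃[o]m+o≡n; m≤n⇒m<n∨m≡n; <-asym; ≤-antisym; ≮⇒≥)
open import Data.Fin using (Fin; toℕ; fromℕ<) renaming (zero to fzero; suc to fsuc)
open import Data.Fin.Properties using (pigeonhole; any?; toℕ-fromℕ<; toℕ-injective; injective⇒≤; _≟_)
open import Data.Product using (∃; _×_; _,_; proj₁; proj₂)
open import Data.Sum using (_⊎_; inj₁; inj₂)
open import Data.Empty using (⊥-elim)
open import Data.List using (List; []; _∷_; [_]; length; lookup)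
open import Data.List.Membership.Propositional using (_∈_; _∉_)
open import Data.List.Membership.Propositional.Properties using (∈-lookup)
open import Data.List.Membership.Setoid.Properties using (index-injective)
import Data.List.Membership.DecPropositional as DecMembership
open import Data.List.Relation.Unary.Any as Any using (here; there)
open import Data.List.Relation.Unary.All as All using ([]; _∷_)
open import Data.List.Relation.Unary.AllPairs using ([]; _∷_)
open import Data.List.Relation.Unary.Unique.Propositional using (Unique)
open import Relation.Nullary using (¬_; Dec; yes; no)
open import Relation.Nullary.Decidable using (¬?; _×-dec_)
open import Relation.Binary.PropositionalEquality
  using (_≡_; _≢_; refl; sym; trans; cong; subst; ≢-sym; setoid)
open import Function using (_∘_; id)
open import Function.Bundles using (_⇔_; mk⇔; Equivalence)
open import Algebra.Bundles using (Group)
open import Algebra.Structures using (IsGroup)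
import Algebra.Properties.Group as GroupProperties

≢-respects : ∀ {A : Set} {a a′ b b′ : A} → a ≡ a′ → b ≡ b′ → a′ ≢ b′ → a ≢ b
≢-respects refl refl a′≢b′ = a′≢b′

unique₂ : ∀ {A : Set} {a b : A} → a ≢ b → Unique (a ∷ b ∷ [])
unique₂ ab = (ab ∷ []) ∷ [] ∷ []

unique₃ : ∀ {A : Set} {a b c : A} → a ≢ b → a ≢ c → b ≢ c → Unique (a ∷ b ∷ c ∷ [])
unique₃ ab ac bc = (ab ∷ ac ∷ []) ∷ (bc ∷ []) ∷ [] ∷ []

unique₄ : ∀ {A : Set} {a b c d : A} → a ≢ b → a ≢ c → a ≢ d → b ≢ c → b ≢ d → c ≢ d →
          Unique (a ∷ b ∷ c ∷ d ∷ [])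
unique₄ ab ac ad bc bd cd = (ab ∷ ac ∷ ad ∷ []) ∷ (bc ∷ bd ∷ []) ∷ (cd ∷ []) ∷ [] ∷ []

lookup-injective : ∀ {A : Set} {xs : List A} → Unique xs → ∀ {i j} → lookup xs i ≡ lookup xs j → i ≡ j
lookup-injective (_ ∷ _)      {fzero}  {fzero}  _  = refl
lookup-injective (x∉ ∷ _)     {fzero}  {fsuc j} eq = ⊥-elim (All.lookup x∉ (∈-lookup j) eq)
lookup-injective (x∉ ∷ _)     {fsuc i} {fzero}  eq = ⊥-elim (All.lookup x∉ (∈-lookup i) (sym eq))
lookup-injective (_ ∷ unique) {fsuc i} {fsuc j} eq = cong fsuc (lookup-injective unique eq)

module ShortPaths {N : ℕ} {E : Fin N → Fin N → Set} {k : ℕ} (ζ : EdgeColoring E k) where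
  open EdgeColoring ζ using (col)

  stay : ∀ u → RainbowPath E ζ u u
  stay u = [ u ] , [] , here u , [] ∷ [] , []

  edge₁ : ∀ {u v} → E u v → u ≢ v → RainbowPath E ζ u v
  edge₁ {v = v} e u≢v = _ , _ , step e (here v) , unique₂ u≢v , [] ∷ []

  edges₂ : ∀ {u v w} (e : E u v) (f : E v w) → u ≢ v → u ≢ w → v ≢ w →
           col _ _ e ≢ col _ _ f → RainbowPath E ζ u w
  edges₂ {w = w} e f uv uw vw ef =
    _ , _ , step e (step f (here w)) , unique₃ uv uw vw , unique₂ ef

  edges₃ : ∀ {u v w x} (e : E u v) (f : E v w) (g : E w x) →
           u ≢ v → u ≢ w → u ≢ x → v ≢ w → v ≢ x → w ≢ x →
           col _ _ e ≢ col _ _ f → col _ _ e ≢ col _ _ g → col _ _ f ≢ col _ _ g →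
           RainbowPath E ζ u x
  edges₃ {x = x} e f g uv uw ux vw vx wx ef eg fg =
    _ , _ , step e (step f (step g (here x))) , unique₄ uv uw ux vw vx wx , unique₃ ef eg fg

module PendantBound {N : ℕ} (E : Fin N → Fin N → Set)
  (E-sym : ∀ {x y} → E x y → E y x) (E-irrefl : ∀ {x y} → E x y → x ≢ y)
  (h : Fin N) {m : ℕ} (leaf : Fin m → Fin N)
  (leaf-injective : ∀ {i j} → leaf i ≡ leaf j → i ≡ j)
  (leaf-adj : ∀ i → E (leaf i) h) (leaf-pendant : ∀ i {y} → E (leaf i) y → y ≡ h) where

  module _ {k : ℕ} (ζ : EdgeColoring E k) (rainbow : IsRainbowColoring E ζ) where
    open EdgeColoring ζ

    col-flip : ∀ {x y} (p : E x y) (q : E y x) → col x y p ≡ col y x q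
    col-flip {x} {y} p q = symm x y p q

    col-cong : ∀ {x x′ y y′} (p : E x y) (p′ : E x′ y′) → x ≡ x′ → y ≡ y′ →
               col x y p ≡ col x′ y′ p′
    col-cong p p′ refl refl = trans (col-flip p (E-sym p)) (col-flip (E-sym p) p′)

    avoid-hub : ∀ {y i vs cs} → ColWalk E col y (leaf i) vs cs → h ∉ vs → y ≡ leaf i
    avoid-hub (here _)   _  = refl
    avoid-hub (step e w) h∉ with avoid-hub w (h∉ ∘ there)
    ... | refl = ⊥-elim (h∉ (here (sym (leaf-pendant _ (E-sym e)))))

    leafColour : Fin m → Fin k
    leafColour i = col (leaf i) h (leaf-adj i)

    -- A rainbow path between distinct leaves starts with one hub edge and ends with the
    -- other, so their colours differ.
    leaves-differ : ∀ {x y vs cs} i j → x ≡ leaf i → y ≡ leaf j → x ≢ y →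
                    ColWalk E col x y vs cs → Unique vs → Unique cs → leafColour i ≢ leafColour j
    leaves-differ i j _ _ x≢y (here _) _ _ = ⊥-elim (x≢y refl)
    leaves-differ i j refl refl _ (step e (here _)) _ _ =
      ⊥-elim (E-irrefl (leaf-adj j) (leaf-pendant i e))
    leaves-differ i j refl refl _ (step e (step f w)) (_ ∷ (y₁∉ ∷ _)) ((c₁≢c₂ ∷ _) ∷ _) =
      ≢-respects (sym (col-cong e (leaf-adj i) refl y₁≡h))
                 (sym (trans (col-flip f (E-sym f)) (col-cong (E-sym f) (leaf-adj j) y₂≡leaf y₁≡h)))
                 c₁≢c₂
      where
      y₁≡h = leaf-pendant i e
      y₂≡leaf = avoid-hub w (λ h∈ → All.lookup y₁∉ h∈ y₁≡h)

    leafColour-injective : ∀ {i j} → leafColour i ≡ leafColour j → i ≡ j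
    leafColour-injective {i} {j} eq with i ≟ j
    ... | yes i≡j = i≡j
    ... | no i≢j with rainbow (leaf i) (leaf j)
    ...   | _ , _ , walk , unique-vs , unique-cs =
      ⊥-elim (leaves-differ i j refl refl (i≢j ∘ leaf-injective) walk unique-vs unique-cs eq)

  pendant-bound : ∀ {k} → HasRainbowColoring E k → m ≤ k
  pendant-bound (ζ , rainbow) = injective⇒≤ (leafColour-injective ζ rainbow)

module _ {N : ℕ} (E : Fin N → Fin N → Set) (h : Fin N) {k : ℕ} (κ : Fin N → Fin k) where

  record Detour (v p : Fin N) (κv c : Fin k) : Set where
    field
      adj   : E p v
      p≢h   : p ≢ h
      κp≢κv : κ p ≢ κv
      c≢κv  : c ≢ κv
      κp≢c  : κ p ≢ c

module HubColouring {N : ℕ} (E : Fin N → Fin N → Set)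
  (E-sym : ∀ {x y} → E x y → E y x) (E-irrefl : ∀ {x y} → E x y → x ≢ y)
  (h : Fin N) (hub-adj : ∀ {v} → v ≢ h → E v h)
  {k : ℕ} (κ : Fin N → Fin k) (spare : Fin k)
  -- each vertex v names a partner d v and a colour δ v for the edge {d v, v};
  -- mutual partners must agree on that colour
  (d : Fin N → Fin N) (δ : Fin N → Fin k)
  (partners-agree : ∀ a → d a ≢ a → d (d a) ≡ a → δ (d a) ≡ δ a)
  (Leaf : Fin N → Set) (leaf? : ∀ v → Dec (Leaf v))
  (leaf-injective : ∀ {u v} → Leaf u → Leaf v → κ u ≡ κ v → u ≡ v)
  (detour : ∀ {v} → v ≢ h → ¬ Leaf v → Detour E h κ v (d v) (κ v) (δ v)) where

  mutual-partners : ∀ {a b} → a ≢ b → b ≡ d a → a ≡ d b → δ a ≡ δ b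
  mutual-partners {a} a≢b refl a≡dda = sym (partners-agree a (≢-sym a≢b) (sym a≡dda))

  -- Colour of the pair {a, b}: hub edges get κ of the other end, partner edges get δ.
  colourBy : ∀ {a b} → Dec (a ≡ h) → Dec (b ≡ h) → Dec (b ≡ d a) → Dec (a ≡ d b) → Fin k
  colourBy {b = b} (yes _) _       _       _       = κ b
  colourBy {a}     (no _)  (yes _) _       _       = κ a
  colourBy {a}     (no _)  (no _)  (yes _) _       = δ a
  colourBy {b = b} (no _)  (no _)  (no _)  (yes _) = δ b
  colourBy         (no _)  (no _)  (no _)  (no _)  = spare

  colour : Fin N → Fin N → Fin k
  colour a b = colourBy (a ≟ h) (b ≟ h) (b ≟ d a) (a ≟ d b)

  colourBy-sym : ∀ {a b} → a ≢ b →
                 (p : Dec (a ≡ h)) (q : Dec (b ≡ h)) (r : Dec (b ≡ d a)) (s : Dec (a ≡ d b)) →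
                 colourBy p q r s ≡ colourBy q p s r
  colourBy-sym a≢b (yes a≡h) (yes b≡h) _ _ = ⊥-elim (a≢b (trans a≡h (sym b≡h)))
  colourBy-sym _   (yes _)   (no _)    _ _ = refl
  colourBy-sym _   (no _)    (yes _)   _ _ = refl
  colourBy-sym a≢b (no _) (no _) (yes b≡da) (yes a≡db) = mutual-partners a≢b b≡da a≡db
  colourBy-sym _   (no _) (no _) (yes _) (no _)  = refl
  colourBy-sym _   (no _) (no _) (no _)  (yes _) = refl
  colourBy-sym _   (no _) (no _) (no _)  (no _)  = refl

  colourBy-hub : ∀ {a b} → a ≡ h →
                 (p : Dec (a ≡ h)) (q : Dec (b ≡ h)) (r : Dec (b ≡ d a)) (s : Dec (a ≡ d b)) →
                 colourBy p q r s ≡ κ b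
  colourBy-hub _   (yes _)   _ _ _ = refl
  colourBy-hub a≡h (no a≢h)  _ _ _ = ⊥-elim (a≢h a≡h)

  colourBy-partner : ∀ {a b} → a ≢ h → b ≢ h → a ≢ b → a ≡ d b →
                     (p : Dec (a ≡ h)) (q : Dec (b ≡ h)) (r : Dec (b ≡ d a)) (s : Dec (a ≡ d b)) →
                     colourBy p q r s ≡ δ b
  colourBy-partner a≢h _   _   _    (yes a≡h) _ _ _ = ⊥-elim (a≢h a≡h)
  colourBy-partner _   b≢h _   _    (no _) (yes b≡h) _ _ = ⊥-elim (b≢h b≡h)
  colourBy-partner _   _   a≢b a≡db (no _) (no _) (yes b≡da) _ = mutual-partners a≢b b≡da a≡db
  colourBy-partner _   _   _   _    (no _) (no _) (no _) (yes _) = refl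
  colourBy-partner _   _   _   a≡db (no _) (no _) (no _) (no a≢db) = ⊥-elim (a≢db a≡db)

  colour-sym : ∀ {a b} → a ≢ b → colour a b ≡ colour b a
  colour-sym {a} {b} a≢b = colourBy-sym a≢b (a ≟ h) (b ≟ h) (b ≟ d a) (a ≟ d b)

  colour-hubˡ : ∀ v → colour h v ≡ κ v
  colour-hubˡ v = colourBy-hub refl (h ≟ h) (v ≟ h) (v ≟ d h) (h ≟ d v)

  colour-hubʳ : ∀ {v} → v ≢ h → colour v h ≡ κ v
  colour-hubʳ {v} v≢h = trans (colour-sym v≢h) (colour-hubˡ v)

  colour-partner : ∀ {v} → v ≢ h → d v ≢ h → d v ≢ v → colour (d v) v ≡ δ v
  colour-partner {v} v≢h dv≢h dv≢v =
    colourBy-partner dv≢h v≢h dv≢v refl (d v ≟ h) (v ≟ h) (v ≟ d (d v)) (d v ≟ d v)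

  ζ : EdgeColoring E k
  ζ = record { col = λ x y _ → colour x y ; symm = λ x y e _ → colour-sym (E-irrefl e) }

  open ShortPaths ζ

  hub-adjˡ : ∀ {v} → v ≢ h → E h v
  hub-adjˡ = E-sym ∘ hub-adj

  via-hub : ∀ {u v} → u ≢ v → u ≢ h → v ≢ h → κ u ≢ κ v → RainbowPath E ζ u v
  via-hub {u} {v} u≢v u≢h v≢h κu≢κv =
    edges₂ (hub-adj u≢h) (hub-adjˡ v≢h) u≢h u≢v (≢-sym v≢h)
           (≢-respects (colour-hubʳ u≢h) (colour-hubˡ v) κu≢κv)

  -- u – h – d v – v, using the detour of v; the edge colours are κ u, κ (d v), δ v.
  detour-into : ∀ {u v} → u ≢ v → u ≢ h → v ≢ h → κ u ≡ κ v →
                Detour E h κ v (d v) (κ v) (δ v) → RainbowPath E ζ u v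
  detour-into {u} {v} u≢v u≢h v≢h κu≡κv D =
    edges₃ (hub-adj u≢h) (hub-adjˡ p≢h) adj
           u≢h u≢p u≢v (≢-sym p≢h) (≢-sym v≢h) p≢v
           (≢-respects col₁ col₂ (≢-respects κu≡κv refl (≢-sym κp≢κv)))
           (≢-respects col₁ col₃ (≢-respects κu≡κv refl (≢-sym c≢κv)))
           (≢-respects col₂ col₃ κp≢c)
    where
    open Detour D
    p≢v : d v ≢ v
    p≢v = κp≢κv ∘ cong κ
    u≢p : u ≢ d v
    u≢p u≡p = κp≢κv (trans (cong κ (sym u≡p)) κu≡κv)
    col₁ : colour u h ≡ κ u
    col₁ = colour-hubʳ u≢h
    col₂ : colour h (d v) ≡ κ (d v)
    col₂ = colour-hubˡ (d v)
    col₃ : colour (d v) v ≡ δ v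
    col₃ = colour-partner v≢h p≢h p≢v

  -- u – d u – h – v, using the detour of u; the edge colours are δ u, κ (d u), κ v.
  detour-out-of : ∀ {u v} → u ≢ v → u ≢ h → v ≢ h → κ u ≡ κ v →
                  Detour E h κ u (d u) (κ u) (δ u) → RainbowPath E ζ u v
  detour-out-of {u} {v} u≢v u≢h v≢h κu≡κv D =
    edges₃ (E-sym adj) (hub-adj p≢h) (hub-adjˡ v≢h)
           (≢-sym p≢u) u≢h u≢v p≢h p≢v (≢-sym v≢h)
           (≢-respects col₁ col₂ (≢-sym κp≢c))
           (≢-respects col₁ col₃ (≢-respects refl (sym κu≡κv) c≢κv))
           (≢-respects col₂ col₃ (≢-respects refl (sym κu≡κv) κp≢κv))
    where
    open Detour D
    p≢u : d u ≢ u
    p≢u = κp≢κv ∘ cong κ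
    p≢v : d u ≢ v
    p≢v p≡v = κp≢κv (trans (cong κ p≡v) (sym κu≡κv))
    col₁ : colour u (d u) ≡ δ u
    col₁ = trans (colour-sym (≢-sym p≢u)) (colour-partner u≢h p≢h p≢u)
    col₂ : colour (d u) h ≡ κ (d u)
    col₂ = colour-hubʳ p≢h
    col₃ : colour h v ≡ κ v
    col₃ = colour-hubˡ v

  between : ∀ {u v} → u ≢ v → u ≢ h → v ≢ h → RainbowPath E ζ u v
  between {u} {v} u≢v u≢h v≢h with κ u ≟ κ v
  ... | no κu≢κv = via-hub u≢v u≢h v≢h κu≢κv
  ... | yes κu≡κv with leaf? u | leaf? v
  ...   | _      | no ¬lv  = detour-into u≢v u≢h v≢h κu≡κv (detour v≢h ¬lv)
  ...   | no ¬lu | yes _   = detour-out-of u≢v u≢h v≢h κu≡κv (detour u≢h ¬lu)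
  ...   | yes lu | yes lv  = ⊥-elim (u≢v (leaf-injective lu lv κu≡κv))

  rainbow : IsRainbowColoring E ζ
  rainbow u v with u ≟ v | u ≟ h | v ≟ h
  ... | yes refl | _        | _        = stay u
  ... | no u≢v   | yes refl | _        = edge₁ (hub-adjˡ (≢-sym u≢v)) u≢v
  ... | no u≢v   | no u≢h   | yes refl = edge₁ (hub-adj u≢h) u≢v
  ... | no u≢v   | no u≢h   | no v≢h   = between u≢v u≢h v≢h

  hub-rainbow-colouring : HasRainbowColoring E k
  hub-rainbow-colouring = ζ , rainbow

module PowerGraph (G : FiniteGroup) where
  open FiniteGroup G
  open IsGroup isGroup using (assoc; identityˡ; identityʳ; inverseʳ)

  private
    group : Group 0ℓ 0ℓ
    group = record { Carrier = Fin n ; _≈_ = _≡_ ; _∙_ = _∙_ ; ε = ε ; _⁻¹ = _⁻¹ ; isGroup = isGroup }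

  open GroupProperties group using (inverseʳ-unique; ⁻¹-involutive; ∙-cancelʳ) public

  infixr 30 _^_
  _^_ : Fin n → ℕ → Fin n
  x ^ k = pow G x k

  ^-+ : ∀ x a b → x ^ (a + b) ≡ x ^ a ∙ x ^ b
  ^-+ x zero    b = sym (identityˡ _)
  ^-+ x (suc a) b = trans (cong (x ∙_) (^-+ x a b)) (sym (assoc x _ _))

  ε^ : ∀ k → ε ^ k ≡ ε
  ε^ zero    = refl
  ε^ (suc k) = trans (identityˡ _) (ε^ k)

  -- Some positive power of x is ε: two of x⁰ … xⁿ coincide, and we cancel.
  finite-order : ∀ x → ∃ λ q → x ^ suc q ≡ ε
  finite-order x with pigeonhole ≤-refl (λ (i : Fin (suc n)) → x ^ toℕ i)
  ... | i , j , i<j , xⁱ≡xʲ with m≤n⇒∃[o]m+o≡n i<j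
  ... | o , i+1+o≡j = o , ∙-cancelʳ (x ^ toℕ i) _ _ xᵒ⁺¹xⁱ≡εxⁱ
    where
    xᵒ⁺¹xⁱ≡εxⁱ : x ^ suc o ∙ x ^ toℕ i ≡ ε ∙ x ^ toℕ i
    xᵒ⁺¹xⁱ≡εxⁱ = trans (sym (^-+ x (suc o) (toℕ i)))
                   (trans (cong (x ^_) (trans (cong suc (+-comm o (toℕ i))) i+1+o≡j))
                   (trans (sym xⁱ≡xʲ) (sym (identityˡ _))))

  reduce-exponent : ∀ x q → x ^ suc q ≡ ε → ∀ k → ∃ λ r → r ≤ q × x ^ k ≡ x ^ r
  reduce-exponent x q xq≡ε zero = zero , z≤n , refl
  reduce-exponent x q xq≡ε (suc k) with reduce-exponent x q xq≡ε k
  ... | r , r≤q , xᵏ≡xʳ with m≤n⇒m<n∨m≡n r≤q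
  ...   | inj₁ r<q  = suc r , r<q , cong (x ∙_) xᵏ≡xʳ
  ...   | inj₂ refl = zero , z≤n , trans (cong (x ∙_) xᵏ≡xʳ) xq≡ε

  -- Membership in a cyclic subgroup is decidable: only exponents up to the order matter.
  inCyclic? : ∀ y z → Dec (InCyclic G y z)
  inCyclic? y z with finite-order y
  ... | q , yq≡ε with any? (λ (i : Fin (suc q)) → y ^ toℕ i ≟ z)
  ... | yes (i , yⁱ≡z) = yes (toℕ i , yⁱ≡z)
  ... | no none = no λ { (k , yᵏ≡z) →
          let (r , r≤q , yᵏ≡yʳ) = reduce-exponent y q yq≡ε k in
          none (fromℕ< (s≤s r≤q) ,
                trans (cong (y ^_) (toℕ-fromℕ< (s≤s r≤q))) (trans (sym yᵏ≡yʳ) yᵏ≡z)) }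

  inverse-in-cyclic : ∀ x → InCyclic G x (x ⁻¹)
  inverse-in-cyclic x with finite-order x
  ... | q , xq≡ε = q , inverseʳ-unique x (x ^ q) xq≡ε

  involution-powers : ∀ {x} → x ∙ x ≡ ε → ∀ k → x ^ k ≡ ε ⊎ x ^ k ≡ x
  involution-powers xx zero = inj₁ refl
  involution-powers {x} xx (suc k) with involution-powers xx k
  ... | inj₁ xᵏ≡ε = inj₂ (trans (cong (x ∙_) xᵏ≡ε) (identityʳ x))
  ... | inj₂ xᵏ≡x = inj₁ (trans (cong (x ∙_) xᵏ≡x) xx)

  involution-cyclic : ∀ {x y} → x ∙ x ≡ ε → InCyclic G x y → y ≢ x → y ≡ ε
  involution-cyclic xx (k , xᵏ≡y) y≢x with involution-powers xx k
  ... | inj₁ xᵏ≡ε = trans (sym xᵏ≡y) xᵏ≡ε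
  ... | inj₂ xᵏ≡x = ⊥-elim (y≢x (trans (sym xᵏ≡y) xᵏ≡x))

  self-inverse : ∀ {x} → x ∙ x ≡ ε → x ≡ x ⁻¹
  self-inverse {x} xx = inverseʳ-unique x x xx

  nonInvolution-≢-inverse : ∀ {x} → x ∙ x ≢ ε → x ≢ x ⁻¹
  nonInvolution-≢-inverse {x} xx≢ε x≡x⁻¹ = xx≢ε (trans (cong (x ∙_) x≡x⁻¹) (inverseʳ x))

  nonInvolution-inverse : ∀ {x} → x ∙ x ≢ ε → (x ⁻¹) ∙ (x ⁻¹) ≢ ε
  nonInvolution-inverse {x} xx≢ε x⁻¹x⁻¹≡ε =
    nonInvolution-≢-inverse xx≢ε (sym (trans (self-inverse x⁻¹x⁻¹≡ε) (⁻¹-involutive x)))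

  ε-involution : ε ∙ ε ≡ ε
  ε-involution = identityˡ ε

  adj-sym : ∀ {x y} → PowerAdj G x y → PowerAdj G y x
  adj-sym (x≢y , inj₁ y∈⟨x⟩) = ≢-sym x≢y , inj₂ y∈⟨x⟩
  adj-sym (x≢y , inj₂ x∈⟨y⟩) = ≢-sym x≢y , inj₁ x∈⟨y⟩

  adj-irrefl : ∀ {x y} → PowerAdj G x y → x ≢ y
  adj-irrefl = proj₁

  adj-identity : ∀ {x} → x ≢ ε → PowerAdj G x ε
  adj-identity x≢ε = x≢ε , inj₁ (0 , refl)

  adj-inverse : ∀ {x} → x ∙ x ≢ ε → PowerAdj G (x ⁻¹) x
  adj-inverse {x} xx≢ε = ≢-sym (nonInvolution-≢-inverse xx≢ε) , inj₂ (inverse-in-cyclic x)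

  maximal-≢ε : ∀ {x} → IsMaximalInvolution G x → x ≢ ε
  maximal-≢ε ((x≢ε , _) , _) = x≢ε

  maximal-involution : ∀ {x} → IsMaximalInvolution G x → x ∙ x ≡ ε
  maximal-involution ((_ , xx) , _) = xx

  maximal-pendant : ∀ {x y} → IsMaximalInvolution G x → PowerAdj G x y → y ≡ ε
  maximal-pendant ((_ , xx) , _) (x≢y , inj₁ y∈⟨x⟩) = involution-cyclic xx y∈⟨x⟩ (≢-sym x≢y)
  maximal-pendant {x} {y} ((_ , xx) , maximal) (x≢y , inj₂ x∈⟨y⟩) =
    involution-cyclic xx (Equivalence.to (maximal y x∈⟨y⟩ y) (1 , identityʳ y)) (≢-sym x≢y)

  ProperRoot : Fin n → Fin n → Set
  ProperRoot w t = w ≢ t × w ≢ ε × InCyclic G w t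

  root-adj : ∀ {w t} → ProperRoot w t → PowerAdj G w t
  root-adj (w≢t , _ , t∈⟨w⟩) = w≢t , inj₁ t∈⟨w⟩

  root-nonInvolution : ∀ {w t} → t ≢ ε → ProperRoot w t → w ∙ w ≢ ε
  root-nonInvolution t≢ε (w≢t , _ , (k , wᵏ≡t)) ww with involution-powers ww k
  ... | inj₁ wᵏ≡ε = t≢ε (trans (sym wᵏ≡t) wᵏ≡ε)
  ... | inj₂ wᵏ≡w = w≢t (trans (sym wᵏ≡w) wᵏ≡t)

  nonMaximal-root : ∀ {t} → t ≢ ε → t ∙ t ≡ ε → ¬ IsMaximalInvolution G t → ∃ λ w → ProperRoot w t
  nonMaximal-root {t} t≢ε tt not-maximal
    with any? (λ w → ¬? (w ≟ t) ×-dec ¬? (w ≟ ε) ×-dec inCyclic? w t)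
  ... | yes root = root
  ... | no no-root = ⊥-elim (not-maximal ((t≢ε , tt) , maximality))
    where
    maximality : ∀ y → InCyclic G y t → ∀ z → InCyclic G y z ⇔ InCyclic G t z
    maximality y t∈⟨y⟩ z with y ≟ t | y ≟ ε
    ... | yes refl | _        = mk⇔ id id
    ... | no _     | yes refl = ⊥-elim (t≢ε (trans (sym (proj₂ t∈⟨y⟩)) (ε^ (proj₁ t∈⟨y⟩))))
    ... | no y≢t   | no y≢ε   = ⊥-elim (no-root (y , y≢t , y≢ε , t∈⟨y⟩))

module _ (G : FiniteGroup) where
  open FiniteGroup G using (ε)
  open PowerGraph G

  maximal-involutions-bound : ∀ {m k} → NumMaxInvolutions G m → HasRainbowColoring (PowerAdj G) k → m ≤ k
  maximal-involutions-bound (xs , unique , enumerates , refl) =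
    PendantBound.pendant-bound (PowerAdj G) adj-sym adj-irrefl ε (lookup xs)
      (lookup-injective unique) (λ i → adj-identity (maximal-≢ε (leaf-maximal i)))
      (λ i → maximal-pendant (leaf-maximal i))
    where
    leaf-maximal : ∀ i → IsMaximalInvolution G (lookup xs i)
    leaf-maximal i = Equivalence.to (enumerates _) (∈-lookup i)

module MaximalInvolutionColouring (G : FiniteGroup) {m : ℕ} (xs : List (Fin (FiniteGroup.n G)))
  (enumerates : ∀ x → (x ∈ xs) ⇔ IsMaximalInvolution G x) (len : length xs ≡ 3 + m) where
  open FiniteGroup G
  open PowerGraph G
  open DecMembership (_≟_ {n}) using (_∈?_)

  Colour : Set
  Colour = Fin (3 + m)

  -- c₀, c₁ colour non-involutions (x and x⁻¹ receive different ones);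
  -- c₂ colours non-maximal involutions and the edges {x, x⁻¹}.
  c₀ c₁ c₂ : Colour
  c₀ = fzero
  c₁ = fsuc fzero
  c₂ = fsuc (fsuc fzero)

  position : ∀ {x} → x ∈ xs → Colour
  position p = subst Fin len (Any.index p)

  position-injective : ∀ {x y} (p : x ∈ xs) (q : y ∈ xs) → position p ≡ position q → x ≡ y
  position-injective p q eq = index-injective (setoid _) p q (subst-injective len eq)
    where
    subst-injective : ∀ {a b} (e : a ≡ b) {i j : Fin a} → subst Fin e i ≡ subst Fin e j → i ≡ j
    subst-injective refl eq′ = eq′

  orient : ∀ {A : Set} → Dec A → Colour
  orient (yes _) = c₀
  orient (no _)  = c₁

  orient-≢c₂ : ∀ {A : Set} (p : Dec A) → orient p ≢ c₂
  orient-≢c₂ (yes _) ()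
  orient-≢c₂ (no _)  ()

  orient-flip : ∀ {i i′ j : ℕ} → i ≢ j → i′ ≡ i → (p : Dec (i < j)) (q : Dec (j < i′)) → orient p ≢ orient q
  orient-flip _   refl (yes i<j) (yes j<i) _ = <-asym i<j j<i
  orient-flip _   refl (yes _)   (no _)    ()
  orient-flip _   refl (no _)    (yes _)   ()
  orient-flip i≢j refl (no j≮i)  (no i≮j)  _ = i≢j (≤-antisym (≮⇒≥ i≮j) (≮⇒≥ j≮i))

  side : Fin n → Colour
  side x = orient (toℕ x <? toℕ (x ⁻¹))

  side-inverse : ∀ {x} → x ∙ x ≢ ε → side x ≢ side (x ⁻¹)
  side-inverse {x} xx≢ε =
    orient-flip (nonInvolution-≢-inverse xx≢ε ∘ toℕ-injective) (cong toℕ (⁻¹-involutive x))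
                (toℕ x <? toℕ (x ⁻¹)) (toℕ (x ⁻¹) <? toℕ ((x ⁻¹) ⁻¹))

  data Kind (x : Fin n) : Set where
    identity      : x ≡ ε → Kind x
    maximal       : x ∈ xs → Kind x
    nonMaximal    : x ∉ xs → x ≢ ε → x ∙ x ≡ ε → ∃ (λ w → ProperRoot w x) → Kind x
    nonInvolution : x ∙ x ≢ ε → Kind x

  kind : ∀ x → Kind x
  kind x with x ≟ ε | x ∈? xs | x ∙ x ≟ ε
  ... | yes x≡ε | _      | _       = identity x≡ε
  ... | no _    | yes x∈ | _       = maximal x∈
  ... | no x≢ε  | no x∉  | yes xx  = nonMaximal x∉ x≢ε xx
                                       (nonMaximal-root x≢ε xx (x∉ ∘ Equivalence.from (enumerates x)))
  ... | no _    | no _   | no xx≢ε = nonInvolution xx≢ε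

  κ-of : ∀ {x} → Kind x → Colour
  κ-of (identity _)          = c₀
  κ-of (maximal p)           = position p
  κ-of (nonMaximal _ _ _ _)  = c₂
  κ-of {x} (nonInvolution _) = side x

  d-of : ∀ {x} → Kind x → Fin n
  d-of {x} (identity _)            = x
  d-of {x} (maximal _)             = x
  d-of (nonMaximal _ _ _ (w , _))  = w
  d-of {x} (nonInvolution _)       = x ⁻¹

  δ-of : ∀ {x} → Kind x → Colour
  δ-of (nonMaximal _ _ _ (w , _)) = side (w ⁻¹)
  δ-of _                          = c₂

  κ : Fin n → Colour
  κ x = κ-of (kind x)

  d : Fin n → Fin n
  d x = d-of (kind x)

  δ : Fin n → Colour
  δ x = δ-of (kind x)

  -- Whatever the evidence, a non-involution has the kind nonInvolution.
  kind-nonInvolution : ∀ {x} (k : Kind x) → x ∙ x ≢ ε → ∃ λ xx≢ε → k ≡ nonInvolution xx≢ε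
  kind-nonInvolution (identity refl)        xx≢ε = ⊥-elim (xx≢ε ε-involution)
  kind-nonInvolution {x} (maximal x∈)       xx≢ε =
    ⊥-elim (xx≢ε (maximal-involution (Equivalence.to (enumerates x) x∈)))
  kind-nonInvolution (nonMaximal _ _ xx _)  xx≢ε = ⊥-elim (xx≢ε xx)
  kind-nonInvolution (nonInvolution xx≢ε)   _    = xx≢ε , refl

  κ-nonInvolution : ∀ {x} → x ∙ x ≢ ε → κ x ≡ side x
  κ-nonInvolution {x} xx≢ε = cong κ-of (proj₂ (kind-nonInvolution (kind x) xx≢ε))

  d-nonInvolution : ∀ {x} → x ∙ x ≢ ε → d x ≡ x ⁻¹
  d-nonInvolution {x} xx≢ε = cong d-of (proj₂ (kind-nonInvolution (kind x) xx≢ε))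

  δ-nonInvolution : ∀ {x} → x ∙ x ≢ ε → δ x ≡ c₂
  δ-nonInvolution {x} xx≢ε = cong δ-of (proj₂ (kind-nonInvolution (kind x) xx≢ε))

  κ-maximal : ∀ {x} (k : Kind x) → x ∈ xs → ∃ λ (p : x ∈ xs) → κ-of k ≡ position p
  κ-maximal (identity refl) x∈ = ⊥-elim (maximal-≢ε (Equivalence.to (enumerates ε) x∈) refl)
  κ-maximal (maximal p) _ = p , refl
  κ-maximal (nonMaximal x∉ _ _ _) x∈ = ⊥-elim (x∉ x∈)
  κ-maximal {x} (nonInvolution xx≢ε) x∈ =
    ⊥-elim (xx≢ε (maximal-involution (Equivalence.to (enumerates x) x∈)))

  leaf-injective : ∀ {u v} → u ∈ xs → v ∈ xs → κ u ≡ κ v → u ≡ v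
  leaf-injective {u} {v} u∈ v∈ κu≡κv with κ-maximal (kind u) u∈ | κ-maximal (kind v) v∈
  ... | p , κu≡p | q , κv≡q = position-injective p q (trans (sym κu≡p) (trans κu≡κv κv≡q))

  -- Only inverse pairs are mutual partners, and their edge has colour c₂ from both sides.
  partners-agree-of : ∀ {a} (k : Kind a) → d-of k ≢ a → d (d-of k) ≡ a → δ (d-of k) ≡ δ-of k
  partners-agree-of (identity _) a≢a _ = ⊥-elim (a≢a refl)
  partners-agree-of (maximal _)  a≢a _ = ⊥-elim (a≢a refl)
  partners-agree-of {a} (nonMaximal _ a≢ε aa (w , root)) _ dw≡a =
    ⊥-elim (proj₁ root (trans (trans (sym (⁻¹-involutive w)) (cong _⁻¹ w⁻¹≡a)) (sym (self-inverse aa))))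
    where
    w⁻¹≡a : w ⁻¹ ≡ a
    w⁻¹≡a = trans (sym (d-nonInvolution (root-nonInvolution a≢ε root))) dw≡a
  partners-agree-of (nonInvolution aa≢ε) _ _ = δ-nonInvolution (nonInvolution-inverse aa≢ε)

  detour-of : ∀ {v} (k : Kind v) → v ≢ ε → v ∉ xs →
              Detour (PowerAdj G) ε κ v (d-of k) (κ-of k) (δ-of k)
  detour-of (identity v≡ε) v≢ε _ = ⊥-elim (v≢ε v≡ε)
  detour-of (maximal v∈) _ v∉ = ⊥-elim (v∉ v∈)
  detour-of (nonMaximal _ v≢ε _ (w , root)) _ _ = record
    { adj   = root-adj root
    ; p≢h   = proj₁ (proj₂ root)
    ; κp≢κv = ≢-respects (κ-nonInvolution ww≢ε) refl (orient-≢c₂ _)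
    ; c≢κv  = orient-≢c₂ _
    ; κp≢c  = ≢-respects (κ-nonInvolution ww≢ε) refl (side-inverse ww≢ε)
    }
    where
    ww≢ε : w ∙ w ≢ ε
    ww≢ε = root-nonInvolution v≢ε root
  detour-of {v} (nonInvolution vv≢ε) v≢ε _ = record
    { adj   = adj-inverse vv≢ε
    ; p≢h   = λ v⁻¹≡ε → v≢ε (trans (sym (⁻¹-involutive v)) (trans (cong _⁻¹ v⁻¹≡ε) ε⁻¹≡ε))
    ; κp≢κv = ≢-respects (κ-nonInvolution (nonInvolution-inverse vv≢ε)) refl (≢-sym (side-inverse vv≢ε))
    ; c≢κv  = ≢-sym (orient-≢c₂ _)
    ; κp≢c  = ≢-respects (κ-nonInvolution (nonInvolution-inverse vv≢ε)) refl (orient-≢c₂ _)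
    }
    where
    ε⁻¹≡ε : ε ⁻¹ ≡ ε
    ε⁻¹≡ε = sym (self-inverse ε-involution)

  rainbow-colouring : HasRainbowColoring (PowerAdj G) (3 + m)
  rainbow-colouring =
    HubColouring.hub-rainbow-colouring (PowerAdj G) adj-sym adj-irrefl ε adj-identity κ c₀ d δ
      (λ a → partners-agree-of (kind a)) (_∈ xs) (_∈? xs) leaf-injective
      (λ {v} v≢ε v∉ → detour-of (kind v) v≢ε v∉)

proposition2p4 : (G : FiniteGroup) (m : ℕ) →
    NumMaxInvolutions G m → 3 ≤ m →
    RainbowConnectionNumber (PowerAdj G) m
proposition2p4 G .(3 + m) count@(xs , _ , enumerates , len) (s≤s (s≤s (s≤s {n = m} z≤n))) =
  MaximalInvolutionColouring.rainbow-colouring G xs enumerates len ,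
  λ k colouring → maximal-involutions-bound G count colouring
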